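{- Let $G=(V,E)$ be a finite undirected graph with the live-edge sampling described in the context. Given a set $A\subseteq V$, a vertex $v\notin A$ and a neighbour $u\in\Gamma(v)$ of $v$, the probability that there is a simple path of live edges from a vertex of $A$ to $v$ whose last vertex before $v$ is not $u$ is at most $\frac{|A|}{|A|+1}$.
   Context: $\Gamma(v)$ denotes the set of neighbours of $v$. Each undirected edge $\{x,y\}$ is regarded as the two directed edges $(x,y)$ and $(y,x)$. Live-edge sampling: every vertex $w$ with at least one neighbour independently selects exactly one of its incoming directed edges $(x,w)$, $x\in\Gamma(w)$, uniformly at random and declares it "live". Paths of live edges are directed paths consisting of live directed edges. -}

module Defs where

open import Data.Nat using (ℕ; zero; suc)
open import Data.Bool using (Bool; true; false; if_then_else_)
open import Data.Fin using (Fin)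
open import Data.Fin.Subset using (Subset) renaming (_∈_ to _∈ₛ_)
open import Data.Maybe using (Maybe; just; nothing)
open import Data.List using (List; []; _∷_; map; concatMap; filterᵇ; allFin; null; _++_)
open import Data.List.Relation.Unary.Unique.Propositional using (Unique)
open import Data.Vec using (Vec; []; _∷_; tabulate; lookup)
open import Data.Unit using (⊤)
open import Data.Empty using (⊥)
open import Data.Product using (_×_; ∃; ∃-syntax)
open import Relation.Binary.PropositionalEquality using (_≡_; _≢_)

record Graph (n : ℕ) : Set where
  field
    adj   : Fin n → Fin n → Bool
    sym   : ∀ x y → adj x y ≡ adj y x
    irrfl : ∀ x → adj x x ≡ false
open Graph public

Γ : ∀ {n} → Graph n → Fin n → List (Fin n)
Γ {n} G v = filterᵇ (λ x → adj G x v) (allFin n)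

-- The choices of vertex w: one of its incoming edges (x , w), identified by x,
-- or "nothing" if w has no neighbour.
options : ∀ {n} → Graph n → Fin n → List (Maybe (Fin n))
options G w = if null (Γ G w) then nothing ∷ [] else map just (Γ G w)

Sample : ℕ → Set
Sample n = Vec (Maybe (Fin n)) n

prodVec : ∀ {A : Set} {m} → Vec (List A) m → List (Vec A m)
prodVec []         = [] ∷ []
prodVec (os ∷ oss) = concatMap (λ o → map (o ∷_) (prodVec oss)) os

-- The sample space: all live-edge samples, each equally likely
-- (independent uniform choices = uniform on the product).
Ω : ∀ {n} → Graph n → List (Sample n)
Ω {n} G = prodVec (tabulate (options G))

Live : ∀ {n} → Sample n → Fin n → Fin n → Set
Live σ x y = lookup σ y ≡ just x

LiveChain : ∀ {n} → Sample n → List (Fin n) → Set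
LiveChain σ []            = ⊤
LiveChain σ (x ∷ [])      = ⊤
LiveChain σ (x ∷ y ∷ ys)  = Live σ x y × LiveChain σ (y ∷ ys)

StartsIn : ∀ {n} → Subset n → List (Fin n) → Set
StartsIn A []      = ⊥
StartsIn A (x ∷ _) = x ∈ₛ A

Event : ∀ {n} → Subset n → Fin n → Fin n → Sample n → Set
Event {n} A v u σ =
  ∃[ xs ] ∃[ w ]
    (Unique (xs ++ w ∷ v ∷ []) × LiveChain σ (xs ++ w ∷ v ∷ [])
      × StartsIn A (xs ++ w ∷ v ∷ []) × w ≢ u)

-- Map each sample σ of the event E to a pair (ρ , a). Walk backwards from v along live
-- in-edges; let a be the first vertex of A reached and x the vertex just before it.
-- ρ is σ with the live in-edge of x redirected to come from the vertex visited before
-- x on the walk (from u if x = v). In ρ the backward walk from v runs into a cycle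
-- before reaching A, so ρ lies outside the event; and x, hence σ = ρ[x ≔ a], is
-- determined by ρ: either ρ picks u for v and x = v, or x is where the cycle closes.
-- The pairs (σ , a') with a' ∈ A and the images (ρ , a) are thus |E|·|A| + |E|
-- distinct elements of Ω × A.
module Submission where

open import Defs hiding (sym)
open import Data.Nat using (suc; _+_; _*_; _≤_; z≤n; s≤s)
open import Data.Nat.Properties using (+-suc; *-distribˡ-+; *-identityʳ; module ≤-Reasoning)
open import Data.Bool using (true; false; T; if_then_else_)
open import Data.Fin using (Fin; zero; suc)
open import Data.Fin.Properties using (suc-injective)
open import Data.Fin.Subset using (Subset; _∈_; _∉_; ∣_∣)
open import Data.Fin.Subset.Properties using (_∈?_)
open import Data.List using (List; []; _∷_; length; map; _++_; allFin; null; cartesianProduct)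
open import Data.List.Properties using (length-++; length-map; ++-assoc)
open import Data.List.Membership.Propositional using () renaming (_∈_ to _∈ₗ_; _∉_ to _∉ₗ_)
open import Data.List.Membership.Propositional.Properties
  using (∈-∃++; ∈-++⁻; ∈-++⁺ˡ; ∈-++⁺ʳ; ∈-map⁺; ∈-map⁻; ∈-concatMap⁺; ∈-concatMap⁻; ∈-filter⁺; ∈-filter⁻; ∈-allFin; ∈-cartesianProduct⁺; ∈-cartesianProduct⁻)
import Data.List.Membership.Propositional as Membership
open import Data.List.Relation.Binary.Subset.Propositional using (_⊆_)
open import Data.List.Relation.Unary.Any using (here; there)
import Data.List.Relation.Unary.Any as Any
open import Data.List.Relation.Unary.All using (All; []; _∷_)
import Data.List.Relation.Unary.All as All
open import Data.List.Relation.Unary.All.Properties using (All¬⇒¬Any; map⁺)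
open import Data.List.Relation.Unary.Unique.Propositional using (Unique; []; _∷_)
import Data.List.Relation.Unary.Unique.Propositional.Properties as Unique
open import Data.Maybe using (Maybe; just; nothing)
open import Data.Maybe.Properties using (just-injective)
open import Data.Vec using (Vec; []; _∷_; lookup; tabulate; _[_]≔_)
import Data.Vec as Vec
open import Data.Vec.Properties using (lookup∘tabulate; lookup∘update; lookup∘update′; []≔-idempotent; []≔-lookup)
open import Data.Product using (Σ; _×_; _,_; proj₁; proj₂)
open import Data.Sum using (_⊎_; inj₁; inj₂)
open import Data.Empty using (⊥-elim)
open import Data.Unit using (tt)
open import Function using (_∘_)
open import Relation.Nullary using (¬_; yes; no)
open import Relation.Nullary.Decidable using (T?)
open import Relation.Binary.PropositionalEquality

module _ {X : Set} where

  Unique-⊆⇒length≤ : ∀ {xs ys : List X} → Unique xs → xs ⊆ ys → length xs ≤ length ys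
  Unique-⊆⇒length≤ {[]}     _             _     = z≤n
  Unique-⊆⇒length≤ {x ∷ xs} (x∉xs ∷ !xs) xs⊆ys with ∈-∃++ (xs⊆ys (here refl))
  ... | us , vs , refl = begin
    suc (length xs)              ≤⟨ s≤s (Unique-⊆⇒length≤ !xs xs⊆us++vs) ⟩
    suc (length (us ++ vs))      ≡⟨ cong suc (length-++ us) ⟩
    suc (length us + length vs)  ≡⟨ +-suc (length us) (length vs) ⟨
    length us + length (x ∷ vs)  ≡⟨ length-++ us ⟨
    length (us ++ x ∷ vs)        ∎
    where
    open ≤-Reasoning
    xs⊆us++vs : xs ⊆ us ++ vs
    xs⊆us++vs y∈xs with ∈-++⁻ us (xs⊆ys (there y∈xs))
    ... | inj₁ y∈us         = ∈-++⁺ˡ y∈us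
    ... | inj₂ (here refl)  = ⊥-elim (All.lookup x∉xs y∈xs refl)
    ... | inj₂ (there y∈vs) = ∈-++⁺ʳ us y∈vs

module _ {X Y : Set} where

  length-cartesianProduct : (xs : List X) (ys : List Y) →
                            length (cartesianProduct xs ys) ≡ length xs * length ys
  length-cartesianProduct []       ys = refl
  length-cartesianProduct (x ∷ xs) ys = begin
    length (map (x ,_) ys ++ cartesianProduct xs ys)        ≡⟨ length-++ (map (x ,_) ys) ⟩
    length (map (x ,_) ys) + length (cartesianProduct xs ys) ≡⟨ cong₂ _+_ (length-map (x ,_) ys) (length-cartesianProduct xs ys) ⟩
    length ys + length xs * length ys                        ∎
    where open ≡-Reasoning

  fresh-images-bound : ∀ {S Ω : List X} {B : List Y} {T : List (X × Y)} →
    Unique S → Unique B → Unique T → All (_∈ₗ Ω) S → length T ≡ length S →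
    All (λ p → proj₁ p ∈ₗ Ω × proj₁ p ∉ₗ S × proj₂ p ∈ₗ B) T →
    length S * (length B + 1) ≤ length Ω * length B
  fresh-images-bound {S} {Ω} {B} {T} !S !B !T S⊆Ω |T|≡|S| fresh = begin
    length S * (length B + 1)                   ≡⟨ *-distribˡ-+ (length S) (length B) 1 ⟩
    length S * length B + length S * 1          ≡⟨ cong₂ _+_ (length-cartesianProduct S B) (trans |T|≡|S| (sym (*-identityʳ (length S)))) ⟨
    length (cartesianProduct S B) + length T    ≡⟨ length-++ (cartesianProduct S B) ⟨
    length (cartesianProduct S B ++ T)          ≤⟨ Unique-⊆⇒length≤ !S×B++T S×B++T⊆Ω×B ⟩
    length (cartesianProduct Ω B)               ≡⟨ length-cartesianProduct Ω B ⟩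
    length Ω * length B                         ∎
    where
    open ≤-Reasoning
    !S×B++T : Unique (cartesianProduct S B ++ T)
    !S×B++T = Unique.++⁺ (Unique.cartesianProduct⁺ !S !B) !T
      λ (p∈S×B , p∈T) → proj₁ (proj₂ (All.lookup fresh p∈T)) (proj₁ (∈-cartesianProduct⁻ S B p∈S×B))
    S×B++T⊆Ω×B : cartesianProduct S B ++ T ⊆ cartesianProduct Ω B
    S×B++T⊆Ω×B p∈ with ∈-++⁻ (cartesianProduct S B) p∈
    ... | inj₁ p∈S×B = let x∈S , y∈B = ∈-cartesianProduct⁻ S B p∈S×B in
                       ∈-cartesianProduct⁺ (All.lookup S⊆Ω x∈S) y∈B
    ... | inj₂ p∈T   = let x∈Ω , _ , y∈B = All.lookup fresh p∈T in ∈-cartesianProduct⁺ x∈Ω y∈B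

module _ {X B : Set} {P : X → Set} (f : ∀ {x} → P x → B) where

  length-reduce : ∀ {xs} (pxs : All P xs) → length (All.reduce f pxs) ≡ length xs
  length-reduce []         = refl
  length-reduce (px ∷ pxs) = cong suc (length-reduce pxs)

  reduce-All : ∀ {Q : B → Set} {xs} → All (λ x → (px : P x) → Q (f px)) xs →
               (pxs : All P xs) → All Q (All.reduce f pxs)
  reduce-All []       []         = []
  reduce-All (q ∷ qs) (px ∷ pxs) = q px ∷ reduce-All qs pxs

  reduce-Unique : (∀ {x y} (px : P x) (py : P y) → f px ≡ f py → x ≡ y) →
                  ∀ {xs} → Unique xs → (pxs : All P xs) → Unique (All.reduce f pxs)
  reduce-Unique f-inj []            []         = []
  reduce-Unique f-inj (x∉xs ∷ !xs) (px ∷ pxs) =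
    reduce-All (All.map (λ x≢y py → x≢y ∘ f-inj px py) x∉xs) pxs ∷ reduce-Unique f-inj !xs pxs

elements : ∀ {n} → Subset n → List (Fin n)
elements []          = []
elements (true ∷ p)  = zero ∷ map suc (elements p)
elements (false ∷ p) = map suc (elements p)

length-elements : ∀ {n} (p : Subset n) → length (elements p) ≡ ∣ p ∣
length-elements []          = refl
length-elements (true ∷ p)  = cong suc (trans (length-map suc (elements p)) (length-elements p))
length-elements (false ∷ p) = trans (length-map suc (elements p)) (length-elements p)

Unique-elements : ∀ {n} (p : Subset n) → Unique (elements p)
Unique-elements []          = []
Unique-elements (true ∷ p)  =
  map⁺ (All.universal (λ _ ()) (elements p)) ∷ Unique.map⁺ suc-injective (Unique-elements p)
Unique-elements (false ∷ p) = Unique.map⁺ suc-injective (Unique-elements p)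

∈-elements : ∀ {n} (p : Subset n) {i} → i ∈ p → i ∈ₗ elements p
∈-elements (true ∷ p)  {zero}  _              = here refl
∈-elements (true ∷ p)  {suc i} (Vec.there i∈) = there (∈-map⁺ suc (∈-elements p i∈))
∈-elements (false ∷ p) {suc i} (Vec.there i∈) = ∈-map⁺ suc (∈-elements p i∈)

module _ {X : Set} where

  ∈-prodVec⁻ : ∀ {m} {x : X} {xs : Vec X m} {os oss} →
               x ∷ xs ∈ₗ prodVec (os ∷ oss) → x ∈ₗ os × xs ∈ₗ prodVec oss
  ∈-prodVec⁻ {os = os} {oss} p with Membership.find (∈-concatMap⁻ (λ o → map (o ∷_) (prodVec oss)) {xs = os} p)
  ... | o , o∈os , q with ∈-map⁻ (o ∷_) q
  ... | _ , xs∈ , refl = o∈os , xs∈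

  ∈-prodVec⁺ : ∀ {m} {x : X} {xs : Vec X m} {os oss} →
               x ∈ₗ os → xs ∈ₗ prodVec oss → x ∷ xs ∈ₗ prodVec (os ∷ oss)
  ∈-prodVec⁺ {oss = oss} x∈os xs∈ =
    ∈-concatMap⁺ (λ o → map (o ∷_) (prodVec oss)) (Any.map (λ { refl → ∈-map⁺ _ xs∈ }) x∈os)

  ∈-prodVec⇒lookup : ∀ {m} (oss : Vec (List X) m) {xs} → xs ∈ₗ prodVec oss →
                     ∀ i → lookup xs i ∈ₗ lookup oss i
  ∈-prodVec⇒lookup (os ∷ oss) {x ∷ xs} p zero    = proj₁ (∈-prodVec⁻ {os = os} {oss} p)
  ∈-prodVec⇒lookup (os ∷ oss) {x ∷ xs} p (suc i) = ∈-prodVec⇒lookup oss (proj₂ (∈-prodVec⁻ {os = os} {oss} p)) i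

  ∈-prodVec-update : ∀ {m} (oss : Vec (List X) m) {xs} → xs ∈ₗ prodVec oss →
                     ∀ i {y} → y ∈ₗ lookup oss i → xs [ i ]≔ y ∈ₗ prodVec oss
  ∈-prodVec-update (os ∷ oss) {x ∷ xs} p zero    y∈ = ∈-prodVec⁺ {oss = oss} y∈ (proj₂ (∈-prodVec⁻ {os = os} {oss} p))
  ∈-prodVec-update (os ∷ oss) {x ∷ xs} p (suc i) y∈ =
    let x∈os , xs∈ = ∈-prodVec⁻ {os = os} {oss} p in ∈-prodVec⁺ {oss = oss} x∈os (∈-prodVec-update oss xs∈ i y∈)

module _ {n} (G : Graph n) where

  adj⇒just∈options : ∀ {c z} → adj G c z ≡ true → just c ∈ₗ options G z
  adj⇒just∈options {c} {z} c~z = just∈ (Γ G z) c∈Γ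
    where
    c∈Γ : c ∈ₗ Γ G z
    c∈Γ = ∈-filter⁺ (T? ∘ (λ x → adj G x z)) (∈-allFin c) (subst T (sym c~z) tt)
    just∈ : (l : List (Fin n)) → c ∈ₗ l → just c ∈ₗ (if null l then nothing ∷ [] else map just l)
    just∈ (_ ∷ _) = ∈-map⁺ just

  just∈options⇒adj : ∀ {c z} → just c ∈ₗ options G z → adj G c z ≡ true
  just∈options⇒adj {c} {z} p = ∈Γ⇒adj (just∈⇒∈ (Γ G z) p)
    where
    just∈⇒∈ : (l : List (Fin n)) → just c ∈ₗ (if null l then nothing ∷ [] else map just l) → c ∈ₗ l
    just∈⇒∈ []      (here ())
    just∈⇒∈ []      (there ())
    just∈⇒∈ (_ ∷ _) q with ∈-map⁻ just q
    ... | _ , c∈l , refl = c∈l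
    ∈Γ⇒adj : c ∈ₗ Γ G z → adj G c z ≡ true
    ∈Γ⇒adj c∈Γ with adj G c z | proj₂ (∈-filter⁻ (T? ∘ (λ x → adj G x z)) {xs = allFin n} c∈Γ)
    ... | true | _ = refl

  ∈Ω⇒lookup∈options : ∀ {σ} → σ ∈ₗ Ω G → ∀ z → lookup σ z ∈ₗ options G z
  ∈Ω⇒lookup∈options σ∈Ω z =
    subst (_ ∈ₗ_) (lookup∘tabulate (options G) z) (∈-prodVec⇒lookup (tabulate (options G)) σ∈Ω z)

  ∈Ω-Live⇒adj : ∀ {σ c z} → σ ∈ₗ Ω G → Live σ c z → adj G c z ≡ true
  ∈Ω-Live⇒adj σ∈Ω live = just∈options⇒adj (subst (_∈ₗ _) live (∈Ω⇒lookup∈options σ∈Ω _))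

  ∈Ω-update : ∀ {σ c z} → σ ∈ₗ Ω G → adj G c z ≡ true → σ [ z ]≔ just c ∈ₗ Ω G
  ∈Ω-update {z = z} σ∈Ω c~z = ∈-prodVec-update (tabulate (options G)) σ∈Ω z
    (subst (_ ∈ₗ_) (sym (lookup∘tabulate (options G) z)) (adj⇒just∈options c~z))

just-unique : ∀ {X : Set} {m : Maybe X} {x y} → m ≡ just x → m ≡ just y → x ≡ y
just-unique m≡x m≡y = just-injective (trans (sym m≡x) m≡y)

LiveChain-lastEdge : ∀ {n} (σ : Sample n) xs {w v} → LiveChain σ (xs ++ w ∷ v ∷ []) → Live σ w v
LiveChain-lastEdge σ []           (w→v , _) = w→v
LiveChain-lastEdge σ (x ∷ [])     (_ , lc)  = LiveChain-lastEdge σ [] lc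
LiveChain-lastEdge σ (x ∷ y ∷ xs) (_ , lc)  = LiveChain-lastEdge σ (y ∷ xs) lc

-- Walks follow live in-edges backwards; the list argument holds the vertices already
-- visited, most recent first.
module Walks {n} (A : Subset n) where

  data Escape (σ : Sample n) : List (Fin n) → Fin n → Set where
    reach : ∀ {R z}   → z ∈ A → Escape σ R z
    back  : ∀ {R z c} → Live σ c z → c ∉ₗ z ∷ R → Escape σ (z ∷ R) c → Escape σ R z

  data FirstEntry (σ : Sample n) : List (Fin n) → Fin n → Set where
    enter : ∀ {R z a} → z ∉ A → Live σ a z → a ∈ A → FirstEntry σ R z
    pass  : ∀ {R z c} → z ∉ A → Live σ c z → c ∉ₗ z ∷ R → FirstEntry σ (z ∷ R) c → FirstEntry σ R z

  data Trap (ρ : Sample n) : List (Fin n) → Fin n → Set where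
    close : ∀ {R z p} → z ∉ A → Live ρ p z → p ∈ₗ z ∷ R → Trap ρ R z
    step  : ∀ {R z p} → z ∉ A → Live ρ p z → p ∉ₗ z ∷ R → Trap ρ (z ∷ R) p → Trap ρ R z

  escape-along : ∀ {σ} xs {x y} → LiveChain σ (x ∷ xs ++ y ∷ []) → Unique (x ∷ xs ++ y ∷ []) →
                 Escape σ (xs ++ y ∷ []) x → Escape σ [] y
  escape-along []        (x→y , _)  (x∉ ∷ _)  esc = back x→y (All¬⇒¬Any x∉) esc
  escape-along (_ ∷ xs) (x→x′ , lc) (x∉ ∷ !p) esc = escape-along xs lc !p (back x→x′ (All¬⇒¬Any x∉) esc)

  Event⇒Escape : ∀ {σ v u} → Event A v u σ → Escape σ [] v
  Event⇒Escape ([] , w , !p , lc , w∈A , _) = escape-along [] lc !p (reach w∈A)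
  Event⇒Escape {σ} {v} (x ∷ xs , w , !p , lc , x∈A , _) =
    escape-along (xs ++ w ∷ []) (subst (LiveChain σ) path≡ lc) (subst Unique path≡ !p) (reach x∈A)
    where
    path≡ : x ∷ xs ++ w ∷ v ∷ [] ≡ x ∷ (xs ++ w ∷ []) ++ v ∷ []
    path≡ = cong (x ∷_) (sym (++-assoc xs (w ∷ []) (v ∷ [])))

  firstEntry : ∀ {σ R z} → Escape σ R z → z ∉ A → FirstEntry σ R z
  firstEntry (reach z∈A)      z∉A = ⊥-elim (z∉A z∈A)
  firstEntry (back c→z c∉ esc) z∉A with _ ∈? A
  ... | yes c∈A = enter z∉A c→z c∈A
  ... | no  c∉A = pass z∉A c→z c∉ (firstEntry esc c∉A)

  exit : ∀ {σ R z} → FirstEntry σ R z → Fin n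
  exit (enter {z = z} _ _ _) = z
  exit (pass _ _ _ b)        = exit b

  entry : ∀ {σ R z} → FirstEntry σ R z → Fin n
  entry (enter {a = a} _ _ _) = a
  entry (pass _ _ _ b)        = entry b

  beforeExit : ∀ {σ R z} → FirstEntry σ R z → Fin n → Fin n
  beforeExit (enter _ _ _)          p = p
  beforeExit (pass {z = z} _ _ _ b) _ = beforeExit b z

  entry∈A : ∀ {σ R z} (b : FirstEntry σ R z) → entry b ∈ A
  entry∈A (enter _ _ a∈A) = a∈A
  entry∈A (pass _ _ _ b)  = entry∈A b

  Live-entry-exit : ∀ {σ R z} (b : FirstEntry σ R z) → Live σ (entry b) (exit b)
  Live-entry-exit (enter _ a→z _) = a→z
  Live-entry-exit (pass _ _ _ b)  = Live-entry-exit b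

  exit∉ : ∀ {σ R z} (b : FirstEntry σ R z) → z ∉ₗ R → exit b ∉ₗ R
  exit∉ (enter _ _ _)    z∉R = z∉R
  exit∉ (pass _ _ c∉ b) _   = exit∉ b c∉ ∘ there

  trapEnd : ∀ {ρ R z} → Trap ρ R z → Fin n
  trapEnd (close {z = z} _ _ _) = z
  trapEnd (step _ _ _ t)        = trapEnd t

  trapEnd-unique : ∀ {ρ R z} (t t′ : Trap ρ R z) → trapEnd t ≡ trapEnd t′
  trapEnd-unique (close _ _ _) (close _ _ _) = refl
  trapEnd-unique (close _ p→z p∈) (step _ p′→z p′∉ _) with just-unique p→z p′→z
  ... | refl = ⊥-elim (p′∉ p∈)
  trapEnd-unique (step _ p→z p∉ _) (close _ p′→z p′∈) with just-unique p→z p′→z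
  ... | refl = ⊥-elim (p∉ p′∈)
  trapEnd-unique (step _ p→z _ t) (step _ p′→z _ t′) with just-unique p→z p′→z
  ... | refl = trapEnd-unique t t′

  Trap⇒¬Escape : ∀ {ρ R z} → Trap ρ R z → ¬ Escape ρ R z
  Trap⇒¬Escape (close z∉A _ _)  (reach z∈A)     = z∉A z∈A
  Trap⇒¬Escape (step z∉A _ _ _) (reach z∈A)     = z∉A z∈A
  Trap⇒¬Escape (close _ p→z p∈) (back c→z c∉ _) with just-unique p→z c→z
  ... | refl = c∉ p∈
  Trap⇒¬Escape (step _ p→z _ t) (back c→z _ esc) with just-unique p→z c→z
  ... | refl = Trap⇒¬Escape t esc

  redirection-trap : ∀ {σ R z p} (b : FirstEntry σ R z) → p ∈ₗ z ∷ R →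
    Σ (Trap (σ [ exit b ]≔ just (beforeExit b p)) R z) (λ t → trapEnd t ≡ exit b)
  redirection-trap {σ} (enter z∉A _ _) p∈ = close z∉A (lookup∘update _ σ _) p∈ , refl
  redirection-trap {σ} {z = z} (pass z∉A c→z c∉ b) _ =
    let t , end≡ = redirection-trap b (there (here refl)) in
    step z∉A (trans (lookup∘update′ z≢exit σ _) c→z) c∉ t , end≡
    where
    z≢exit : z ≢ exit b
    z≢exit z≡exit = exit∉ b c∉ (here (sym z≡exit))

module Encoding {n} (G : Graph n) (A : Subset n) {v u : Fin n} (v∉A : v ∉ A) (u~v : adj G u v ≡ true) where
  open Walks A

  redirect : ∀ {σ} → FirstEntry σ [] v → Sample n
  redirect {σ} b = σ [ exit b ]≔ just (beforeExit b u)

  adj-beforeExit : ∀ {σ R z p} → σ ∈ₗ Ω G → (b : FirstEntry σ R z) → adj G p z ≡ true →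
                   adj G (beforeExit b p) (exit b) ≡ true
  adj-beforeExit σ∈Ω (enter _ _ _) p~z = p~z
  adj-beforeExit σ∈Ω (pass {z = z} {c} _ c→z _ b) _ =
    adj-beforeExit σ∈Ω b (trans (Graph.sym G z c) (∈Ω-Live⇒adj G σ∈Ω c→z))

  redirect∈Ω : ∀ {σ} → σ ∈ₗ Ω G → (b : FirstEntry σ [] v) → redirect b ∈ₗ Ω G
  redirect∈Ω σ∈Ω b = ∈Ω-update G σ∈Ω (adj-beforeExit σ∈Ω b u~v)

  redirect-restore : ∀ {σ} (b : FirstEntry σ [] v) → redirect b [ exit b ]≔ just (entry b) ≡ σ
  redirect-restore {σ} b = begin
    redirect b [ exit b ]≔ just (entry b)   ≡⟨ []≔-idempotent σ (exit b) ⟩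
    σ [ exit b ]≔ just (entry b)            ≡⟨ cong (σ [ exit b ]≔_) (Live-entry-exit b) ⟨
    σ [ exit b ]≔ lookup σ (exit b)         ≡⟨ []≔-lookup σ (exit b) ⟩
    σ                                       ∎
    where open ≡-Reasoning

  Event⇒¬Live-u : ∀ {σ} → Event A v u σ → ¬ Live σ u v
  Event⇒¬Live-u (xs , _ , _ , lc , _ , w≢u) u→v = w≢u (just-unique (LiveChain-lastEdge _ xs lc) u→v)

  Locates : Sample n → Fin n → Set
  Locates ρ x = (Live ρ u v × x ≡ v) ⊎ (¬ Live ρ u v × Σ (Trap ρ [] v) (λ t → trapEnd t ≡ x))

  Locates-unique : ∀ {ρ x y} → Locates ρ x → Locates ρ y → x ≡ y
  Locates-unique (inj₁ (_ , refl))      (inj₁ (_ , refl))       = refl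
  Locates-unique (inj₁ (u→v , _))       (inj₂ (¬u→v , _))       = ⊥-elim (¬u→v u→v)
  Locates-unique (inj₂ (¬u→v , _))      (inj₁ (u→v , _))        = ⊥-elim (¬u→v u→v)
  Locates-unique (inj₂ (_ , t , refl))  (inj₂ (_ , t′ , refl))  = trapEnd-unique t t′

  Locates⇒¬Event : ∀ {ρ x} → Locates ρ x → ¬ Event A v u ρ
  Locates⇒¬Event (inj₁ (u→v , _))    ev = Event⇒¬Live-u ev u→v
  Locates⇒¬Event (inj₂ (_ , t , _)) ev = Trap⇒¬Escape t (Event⇒Escape ev)

  redirect-Locates-exit : ∀ {σ} → ¬ Live σ u v → (b : FirstEntry σ [] v) → Locates (redirect b) (exit b)
  redirect-Locates-exit {σ} _ (enter _ _ _) = inj₁ (lookup∘update v σ (just u) , refl)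
  redirect-Locates-exit {σ} ¬u→v b@(pass _ _ c∉ b′) =
    inj₂ (¬u→v ∘ trans (sym (lookup∘update′ v≢exit σ _)) , redirection-trap b (here refl))
    where
    v≢exit : v ≢ exit b′
    v≢exit v≡exit = exit∉ b′ c∉ (here (sym v≡exit))

  firstEntryOf : ∀ {σ} → Event A v u σ → FirstEntry σ [] v
  firstEntryOf ev = firstEntry (Event⇒Escape ev) v∉A

  encode : ∀ {σ} → Event A v u σ → Sample n × Fin n
  encode ev = redirect (firstEntryOf ev) , entry (firstEntryOf ev)

  encode-injective : ∀ {σ τ} (ev : Event A v u σ) (ev′ : Event A v u τ) → encode ev ≡ encode ev′ → σ ≡ τ
  encode-injective {σ} {τ} ev ev′ eq = begin
    σ                                              ≡⟨ redirect-restore b ⟨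
    redirect b [ exit b ]≔ just (entry b)          ≡⟨ cong₂ (λ ρ x → ρ [ x ]≔ just (entry b)) ρ≡ exit≡ ⟩
    redirect b′ [ exit b′ ]≔ just (entry b)        ≡⟨ cong (λ a → redirect b′ [ exit b′ ]≔ just a) (cong proj₂ eq) ⟩
    redirect b′ [ exit b′ ]≔ just (entry b′)       ≡⟨ redirect-restore b′ ⟩
    τ                                              ∎
    where
    open ≡-Reasoning
    b = firstEntryOf ev
    b′ = firstEntryOf ev′
    ρ≡ : redirect b ≡ redirect b′
    ρ≡ = cong proj₁ eq
    exit≡ : exit b ≡ exit b′
    exit≡ = Locates-unique (redirect-Locates-exit (Event⇒¬Live-u ev) b)
      (subst (λ ρ → Locates ρ (exit b′)) (sym ρ≡) (redirect-Locates-exit (Event⇒¬Live-u ev′) b′))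

  encode-fresh : ∀ {σ} → σ ∈ₗ Ω G → (ev : Event A v u σ) →
                 proj₁ (encode ev) ∈ₗ Ω G × ¬ Event A v u (proj₁ (encode ev)) × proj₂ (encode ev) ∈ A
  encode-fresh σ∈Ω ev =
    redirect∈Ω σ∈Ω b , Locates⇒¬Event (redirect-Locates-exit (Event⇒¬Live-u ev) b) , entry∈A b
    where b = firstEntryOf ev

lemma8 : ∀ {n} (G : Graph n) (A : Subset n) (v u : Fin n) →
    v ∉ A → adj G u v ≡ true →
    (S : List (Sample n)) → Unique S → All (_∈ₗ Ω G) S → All (Event A v u) S →
    length S * (∣ A ∣ + 1) ≤ length (Ω G) * ∣ A ∣
lemma8 G A v u v∉A u~v S !S S⊆Ω events =
  subst (λ k → length S * (k + 1) ≤ length (Ω G) * k) (length-elements A)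
    (fresh-images-bound !S (Unique-elements A) (reduce-Unique encode encode-injective !S events)
      S⊆Ω (length-reduce encode events) (reduce-All encode (All.map image-fresh S⊆Ω) events))
  where
  open Encoding G A v∉A u~v
  image-fresh : ∀ {σ} → σ ∈ₗ Ω G → (ev : Event A v u σ) →
    proj₁ (encode ev) ∈ₗ Ω G × proj₁ (encode ev) ∉ₗ S × proj₂ (encode ev) ∈ₗ elements A
  image-fresh σ∈Ω ev =
    let ρ∈Ω , ρ∉E , a∈A = encode-fresh σ∈Ω ev in ρ∈Ω , ρ∉E ∘ All.lookup events , ∈-elements A a∈A
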